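{- For integers $m>j\geq 0$ and $n\geq 1$, \[ \sum_{i=0}^{n-1}\mathcal{T}_{mi+j}=\frac{\mathcal{T}_{mn+m+j}+\mathcal{T}_{mn-m+j}+(1-K_{m})\mathcal{T}_{mn+j}}{K_{m}-K_{ -m}}-\frac{\mathcal{T}_{m+j}+\mathcal{T}_{j-m}+(1-K_{m})\mathcal{T}_{j}}{K_{m}-K_{ -m}} \] and \[ \sum_{i=0}^{n-1}\mathcal{K}_{mi+j}=\frac{\mathcal{K}_{mn+m+j}+\mathcal{K}_{mn-m+j}+(1-K_{m})\mathcal{K}_{mn+j}}{K_{m}-K_{ -m}}-\frac{\mathcal{K}_{m+j}+\mathcal{K}_{j-m}+(1-K_{m})\mathcal{K}_{j}}{K_{m}-K_{ -m}}. \]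
   Context: The Tribonacci–Lucas numbers $K_n$ are defined for all integers $n$ by $K_n=K_{n-1}+K_{n-2}+K_{n-3}$ with $K_0=3,K_1=1,K_2=3$ (negative indices via $K_{ -n}=-K_{ -(n-1)}-K_{ -(n-2)}+K_{ -(n-3)}$). The Tribonacci matrix sequence $(\mathcal{T}_n)_{n\in\mathbb{Z}}$ and Tribonacci–Lucas matrix sequence $(\mathcal{K}_n)_{n\in\mathbb{Z}}$ of $3\times 3$ matrices are defined by $\mathcal{T}_n=\mathcal{T}_{n-1}+\mathcal{T}_{n-2}+\mathcal{T}_{n-3}$ and $\mathcal{K}_n=\mathcal{K}_{n-1}+\mathcal{K}_{n-2}+\mathcal{K}_{n-3}$ for all integers $n$ (extended backwards to negative indices), with $\mathcal{T}_0=\begin{pmatrix}1&0&0\\0&1&0\\0&0&1\end{pmatrix}$, $\mathcal{T}_1=\begin{pmatrix}1&1&1\\1&0&0\\0&1&0\end{pmatrix}$, $\mathcal{T}_2=\begin{pmatrix}2&2&1\\1&1&1\\1&0&0\end{pmatrix}$, and $\mathcal{K}_0=\begin{pmatrix}1&2&3\\3&-2&-1\\-1&4&-1\end{pmatrix}$, $\mathcal{K}_1=\begin{pmatrix}3&4&1\\1&2&3\\3&-2&-1\end{pmatrix}$, $\mathcal{K}_2=\begin{pmatrix}7&4&3\\3&4&1\\1&2&3\end{pmatrix}$. -}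

module Defs where

open import Data.Nat using (ℕ; zero; suc)
open import Data.Integer using (ℤ; +_; -[1+_]; _+_; _-_; _*_; -_; 0ℤ)
open import Data.Fin using (Fin; zero; suc)
open import Data.Product using (_×_; _,_; proj₁)

module Recurrence {A : Set} (_⊕_ : A → A → A) (_⊖_ : A → A → A) where

  fwd : A × A × A → ℕ → A × A × A
  fwd t zero = t
  fwd (a , b , c) (suc n) = fwd (b , c , (a ⊕ b) ⊕ c) n

  bwd : A × A × A → ℕ → A × A × A
  bwd t zero = t
  bwd (a , b , c) (suc n) = bwd ((c ⊖ b) ⊖ a , a , b) n

  seq : A × A × A → ℤ → A
  seq t (+ n)      = proj₁ (fwd t n)
  seq t -[1+ n ]   = proj₁ (bwd t (suc n))

Mat : Set
Mat = Fin 3 → Fin 3 → ℤ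

_⊞_ : Mat → Mat → Mat
(A ⊞ B) r s = A r s + B r s

_⊟_ : Mat → Mat → Mat
(A ⊟ B) r s = A r s - B r s

_·_ : ℤ → Mat → Mat
(c · A) r s = c * A r s

zeroM : Mat
zeroM _ _ = 0ℤ

mat : ℤ → ℤ → ℤ → ℤ → ℤ → ℤ → ℤ → ℤ → ℤ → Mat
mat a b c d e f g h i zero zero = a
mat a b c d e f g h i zero (suc zero) = b
mat a b c d e f g h i zero (suc (suc zero)) = c
mat a b c d e f g h i (suc zero) zero = d
mat a b c d e f g h i (suc zero) (suc zero) = e
mat a b c d e f g h i (suc zero) (suc (suc zero)) = f
mat a b c d e f g h i (suc (suc zero)) zero = g
mat a b c d e f g h i (suc (suc zero)) (suc zero) = h
mat a b c d e f g h i (suc (suc zero)) (suc (suc zero)) = i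

K : ℤ → ℤ
K = Recurrence.seq _+_ _-_ (+ 3 , + 1 , + 3)

𝒯 : ℤ → Mat
𝒯 = Recurrence.seq _⊞_ _⊟_
  ( mat (+ 1) (+ 0) (+ 0) (+ 0) (+ 1) (+ 0) (+ 0) (+ 0) (+ 1)
  , mat (+ 1) (+ 1) (+ 1) (+ 1) (+ 0) (+ 0) (+ 0) (+ 1) (+ 0)
  , mat (+ 2) (+ 2) (+ 1) (+ 1) (+ 1) (+ 1) (+ 1) (+ 0) (+ 0) )

𝒦 : ℤ → Mat
𝒦 = Recurrence.seq _⊞_ _⊟_
  ( mat (+ 1) (+ 2) (+ 3) (+ 3) (- + 2) (- + 1) (- + 1) (+ 4) (- + 1)
  , mat (+ 3) (+ 4) (+ 1) (+ 1) (+ 2) (+ 3) (+ 3) (- + 2) (- + 1)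
  , mat (+ 7) (+ 4) (+ 3) (+ 3) (+ 4) (+ 1) (+ 1) (+ 2) (+ 3) )

sumM : ℕ → (ℕ → Mat) → Mat
sumM zero f = zeroM
sumM (suc n) f = sumM n f ⊞ f n

numer : (ℤ → Mat) → ℤ → ℤ → Mat
numer X m a = (X (a + m) ⊞ X (a - m)) ⊞ ((+ 1 - K m) · X a)

{-# OPTIONS --safe #-}
module Submission where

-- Shifting a tribonacci sequence by one step is multiplication by ε in
-- ℤ[ε] = ℤ[x]/(x³ - x² - x - 1), so shifting by m is multiplication by u = εᵐ.
-- Cayley–Hamilton for multiplication by u gives the three-term recurrence
--   g (p + 3m) = tr u · g (p + 2m) - σ₂ u · g (p + m) + N u · g p
-- along every arithmetic progression of difference m, where N u = 1 because
-- N ε = 1, tr u = K m, and σ₂ u = tr u⁻¹ = K (-m). By this recurrence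
-- (K m - K (-m)) · g a is the difference of two consecutive values of
-- a ↦ g (a + m) + g (a - m) + (1 - K m) · g a, so the sum telescopes.
-- Matrix sequences are handled entrywise.

open import Level using (0ℓ)
open import Algebra.Bundles.Raw using (RawRing)
open import Data.Nat using (ℕ; zero; suc)
open import Data.Product using (_×_; _,_; proj₁)

-- The arithmetic of R[ε] is written over a bare raw ring so that it can be
-- instantiated both at ℤ and at the ring solver's polynomial syntax.
module TribonacciAlgebra (R : RawRing 0ℓ 0ℓ) where
  open RawRing R renaming (Carrier to A)

  private
    infixl 6 _-_
    _-_ : A → A → A
    x - y = x + - y

  infixl 6 _⊕_
  infixr 7 _⋆_ _⊛_
  infixr 8 _^_
  infix 5 _∙_

  -- (a , b , c) stands for a + b ε + c ε²
  R[ε] : Set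
  R[ε] = A × A × A

  1ε : R[ε]
  1ε = (1# , 0# , 0#)

  ε* : R[ε] → R[ε]
  ε* (a , b , c) = (c , a + c , b + c)

  ε^_ : ℕ → R[ε]
  ε^ zero = 1ε
  ε^ suc m = ε* (ε^ m)

  _⊕_ : R[ε] → R[ε] → R[ε]
  (a , b , c) ⊕ (a′ , b′ , c′) = (a + a′ , b + b′ , c + c′)

  _⋆_ : A → R[ε] → R[ε]
  k ⋆ (a , b , c) = (k * a , k * b , k * c)

  _⊛_ : R[ε] → R[ε] → R[ε]
  (a , b , c) ⊛ v = a ⋆ v ⊕ b ⋆ ε* v ⊕ c ⋆ ε* (ε* v)

  _^_ : R[ε] → ℕ → R[ε]
  u ^ zero = 1ε
  u ^ suc k = u ⊛ u ^ k

  -- u ∙ (x_p , x_{p+1} , x_{p+2}) is the value at p of u applied to the sequence x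
  _∙_ : R[ε] → A × A × A → A
  (a , b , c) ∙ (x , y , z) = a * x + b * y + c * z

  step : A × A × A → A × A × A
  step (x , y , z) = (y , z , x + y + z)

  trace₃ minors₂ det₃ : R[ε] → R[ε] → R[ε] → A
  trace₃ (a₁ , _ , _) (_ , b₂ , _) (_ , _ , c₃) = a₁ + b₂ + c₃
  minors₂ (a₁ , a₂ , a₃) (b₁ , b₂ , b₃) (c₁ , c₂ , c₃) =
    (a₁ * b₂ - b₁ * a₂) + (a₁ * c₃ - c₁ * a₃) + (b₂ * c₃ - c₂ * b₃)
  det₃ (a₁ , a₂ , a₃) (b₁ , b₂ , b₃) (c₁ , c₂ , c₃) =
    a₁ * (b₂ * c₃ - c₂ * b₃) - b₁ * (a₂ * c₃ - c₂ * a₃) + c₁ * (a₂ * b₃ - b₂ * a₃)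

  -- coefficients of the characteristic polynomial of multiplication by u,
  -- whose matrix in the basis 1, ε, ε² has the columns u, ε u, ε² u
  trace σ₂ norm : R[ε] → A
  trace u = trace₃ u (ε* u) (ε* (ε* u))
  σ₂ u = minors₂ u (ε* u) (ε* (ε* u))
  norm u = det₃ u (ε* u) (ε* (ε* u))

open import Defs
open import Data.Nat using (_<_; _≤_)
import Data.Nat as ℕ
open import Data.Integer using (ℤ; +_; -[1+_]; _+_; _-_; _*_; -_; 0ℤ; 1ℤ; +-*-rawRing)
import Data.Integer.Properties as ℤₚ
open import Data.Integer.Solver using (module +-*-Solver)
open +-*-Solver using (Polynomial; solve; _:=_; _:+_; _:*_; :-_; _:-_; con)
open import Data.Integer.Tactic.RingSolver using (solve-∀)
open import Data.Fin using (Fin)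
open import Relation.Binary.PropositionalEquality
  using (_≡_; refl; sym; trans; cong; cong₂; subst; module ≡-Reasoning)
open ≡-Reasoning

polynomials : ℕ → RawRing 0ℓ 0ℓ
polynomials n = record
  { Carrier = Polynomial n
  ; _≈_ = _≡_
  ; _+_ = _:+_
  ; _*_ = _:*_
  ; -_ = :-_
  ; 0# = con 0ℤ
  ; 1# = con 1ℤ
  }

open TribonacciAlgebra +-*-rawRing
private module ₚ {n : ℕ} = TribonacciAlgebra (polynomials n)

1ε-∙ : ∀ w → 1ε ∙ w ≡ proj₁ w
1ε-∙ (x , y , z) = solve 3 (λ x y z → ₚ.1ε ₚ.∙ (x , y , z) := x) refl x y z

ε*-∙ : ∀ u w → ε* u ∙ w ≡ u ∙ step w
ε*-∙ (a , b , c) (x , y , z) = solve 6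
  (λ a b c x y z → ₚ.ε* (a , b , c) ₚ.∙ (x , y , z) := (a , b , c) ₚ.∙ ₚ.step (x , y , z))
  refl a b c x y z

1ε-⊛ : ∀ v w → 1ε ⊛ v ∙ w ≡ v ∙ w
1ε-⊛ (a , b , c) (x , y , z) = solve 6
  (λ a b c x y z → ₚ.1ε ₚ.⊛ (a , b , c) ₚ.∙ (x , y , z) := (a , b , c) ₚ.∙ (x , y , z))
  refl a b c x y z

⊛-1ε : ∀ u w → u ⊛ 1ε ∙ w ≡ u ∙ w
⊛-1ε (a , b , c) (x , y , z) = solve 6
  (λ a b c x y z → (a , b , c) ₚ.⊛ ₚ.1ε ₚ.∙ (x , y , z) := (a , b , c) ₚ.∙ (x , y , z))
  refl a b c x y z

ε*-⊛ : ∀ u v w → ε* u ⊛ v ∙ w ≡ ε* (u ⊛ v) ∙ w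
ε*-⊛ (a , b , c) (d , e , f) (x , y , z) = solve 9
  (λ a b c d e f x y z → let u = (a , b , c) ; v = (d , e , f) ; w = (x , y , z) in
    ₚ.ε* u ₚ.⊛ v ₚ.∙ w := ₚ.ε* (u ₚ.⊛ v) ₚ.∙ w)
  refl a b c d e f x y z

cayley-hamilton : ∀ u w →
  u ^ 3 ∙ w ≡ trace u * (u ^ 2 ∙ w) - σ₂ u * (u ∙ w) + norm u * (1ε ∙ w)
cayley-hamilton (a , b , c) (x , y , z) = solve 6
  (λ a b c x y z → let u = (a , b , c) ; w = (x , y , z) in
    u ₚ.^ 3 ₚ.∙ w
      := ₚ.trace u :* (u ₚ.^ 2 ₚ.∙ w) :- ₚ.σ₂ u :* (u ₚ.∙ w) :+ ₚ.norm u :* (ₚ.1ε ₚ.∙ w))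
  refl a b c x y z

trace-∙ : ∀ u → trace u ≡ u ∙ (+ 3 , + 1 , + 3)
trace-∙ (a , b , c) = solve 3
  (λ a b c → ₚ.trace (a , b , c) := (a , b , c) ₚ.∙ (con (+ 3) , con (+ 1) , con (+ 3)))
  refl a b c

norm-ε* : ∀ u → norm (ε* u) ≡ norm u
norm-ε* (a , b , c) = solve 3 (λ a b c → ₚ.norm (ₚ.ε* (a , b , c)) := ₚ.norm (a , b , c)) refl a b c

-- σ₂ (εᵏ u) = tr (ε⁻ᵏ adj u), a tribonacci sequence in -k.
σ₂-ε*³ : ∀ u → σ₂ (ε* (ε* (ε* u))) ≡ σ₂ u - σ₂ (ε* (ε* u)) - σ₂ (ε* u)
σ₂-ε*³ (a , b , c) = solve 3
  (λ a b c → let u = (a , b , c) in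
    ₚ.σ₂ (ₚ.ε* (ₚ.ε* (ₚ.ε* u))) := ₚ.σ₂ u :- ₚ.σ₂ (ₚ.ε* (ₚ.ε* u)) :- ₚ.σ₂ (ₚ.ε* u))
  refl a b c

norm-ε^ : ∀ m → norm (ε^ m) ≡ 1ℤ
norm-ε^ zero = refl
norm-ε^ (suc m) = trans (norm-ε* (ε^ m)) (norm-ε^ m)

record IsTribonacci (g : ℤ → ℤ) : Set where
  constructor isTribonacci
  field
    recurrence : ∀ p → g (p + + 3) ≡ g p + g (p + + 1) + g (p + + 2)

open Recurrence {ℤ} _+_ _-_

unstep : ℤ × ℤ × ℤ → ℤ × ℤ × ℤ
unstep (x , y , z) = (z - y - x , x , y)

step-unstep : ∀ w → step (unstep w) ≡ w
step-unstep (x , y , z) = cong (λ z′ → x , y , z′) (cancel x y z)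
  where
  cancel : ∀ x y z → z - y - x + x + y ≡ z
  cancel = solve-∀

bwd-suc : ∀ t n → bwd t (suc n) ≡ unstep (bwd t n)
bwd-suc t zero = refl
bwd-suc (a , b , c) (suc n) = bwd-suc (c - b - a , a , b) n

fwd-+ : ∀ t n k → fwd t (n ℕ.+ k) ≡ fwd (fwd t n) k
fwd-+ t zero k = refl
fwd-+ (a , b , c) (suc n) k = fwd-+ (b , c , a + b + c) n k

frame : ℤ × ℤ × ℤ → ℤ → ℤ × ℤ × ℤ
frame t (+ n) = fwd t n
frame t -[1+ n ] = bwd t (suc n)

frame-suc : ∀ t p → frame t (p + + 1) ≡ step (frame t p)
frame-suc t (+ n) = fwd-+ t n 1
frame-suc t -[1+ zero ] = sym (step-unstep t)
frame-suc t -[1+ suc n ] =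
  sym (trans (cong step (bwd-suc t (suc n))) (step-unstep (bwd t (suc n))))

frame-+ : ∀ t p k → frame t (p + + k) ≡ fwd (frame t p) k
frame-+ t p zero = cong (frame t) (ℤₚ.+-identityʳ p)
frame-+ t p (suc k) = begin
  frame t (p + + suc k)     ≡⟨ cong (frame t) (sym (ℤₚ.+-assoc p (+ 1) (+ k))) ⟩
  frame t (p + + 1 + + k)   ≡⟨ frame-+ t (p + + 1) k ⟩
  fwd (frame t (p + + 1)) k ≡⟨ cong (λ w → fwd w k) (frame-suc t p) ⟩
  fwd (frame t p) (suc k)   ∎

seq-frame : ∀ t p → seq t p ≡ proj₁ (frame t p)
seq-frame t (+ n) = refl
seq-frame t -[1+ n ] = refl

seq-isTribonacci : ∀ t → IsTribonacci (seq t)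
seq-isTribonacci t = isTribonacci λ p →
  trans (seq-+ p 3) (sym (cong₂ _+_ (cong₂ _+_ (seq-frame t p) (seq-+ p 1)) (seq-+ p 2)))
  where
  seq-+ : ∀ p k → seq t (p + + k) ≡ proj₁ (fwd (frame t p) k)
  seq-+ p k = trans (seq-frame t (p + + k)) (cong proj₁ (frame-+ t p k))

module MatrixRecurrence = Recurrence _⊞_ _⊟_

entry : Fin 3 → Fin 3 → Mat × Mat × Mat → ℤ × ℤ × ℤ
entry r s (A , B , C) = (A r s , B r s , C r s)

fwd-entry : ∀ r s t n → entry r s (MatrixRecurrence.fwd t n) ≡ fwd (entry r s t) n
fwd-entry r s t zero = refl
fwd-entry r s (A , B , C) (suc n) = fwd-entry r s (B , C , (A ⊞ B) ⊞ C) n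

bwd-entry : ∀ r s t n → entry r s (MatrixRecurrence.bwd t n) ≡ bwd (entry r s t) n
bwd-entry r s t zero = refl
bwd-entry r s (A , B , C) (suc n) = bwd-entry r s ((C ⊟ B) ⊟ A , A , B) n

seq-entry : ∀ t r s n → MatrixRecurrence.seq t n r s ≡ seq (entry r s t) n
seq-entry t r s (+ n) = cong proj₁ (fwd-entry r s t n)
seq-entry t r s -[1+ n ] = cong proj₁ (bwd-entry r s t (suc n))

entry-isTribonacci : ∀ t r s → IsTribonacci (λ n → MatrixRecurrence.seq t n r s)
entry-isTribonacci t r s = isTribonacci λ p → begin
  X (p + + 3)                      ≡⟨ entry-seq (p + + 3) ⟩
  x (p + + 3)                      ≡⟨ IsTribonacci.recurrence (seq-isTribonacci (entry r s t)) p ⟩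
  x p + x (p + + 1) + x (p + + 2)
    ≡⟨ sym (cong₂ _+_ (cong₂ _+_ (entry-seq p) (entry-seq (p + + 1))) (entry-seq (p + + 2))) ⟩
  X p + X (p + + 1) + X (p + + 2)  ∎
  where
  X x : ℤ → ℤ
  X n = MatrixRecurrence.seq t n r s
  x = seq (entry r s t)
  entry-seq : ∀ n → X n ≡ x n
  entry-seq = seq-entry t r s

K-isTribonacci : IsTribonacci K
K-isTribonacci = seq-isTribonacci _

window : (ℤ → ℤ) → ℤ → ℤ × ℤ × ℤ
window g p = (g p , g (p + + 1) , g (p + + 2))

act : R[ε] → (ℤ → ℤ) → ℤ → ℤ
act u g p = u ∙ window g p

module _ {g : ℤ → ℤ} (g-trib : IsTribonacci g) where
  open IsTribonacci g-trib

  window-suc : ∀ p → window g (p + + 1) ≡ step (window g p)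
  window-suc p = cong₂ (λ y z → g (p + + 1) , y , z)
    (cong g (ℤₚ.+-assoc p (+ 1) (+ 1)))
    (trans (cong g (ℤₚ.+-assoc p (+ 1) (+ 2))) (recurrence p))

  act-1ε : ∀ p → act 1ε g p ≡ g p
  act-1ε p = 1ε-∙ (window g p)

  act-ε* : ∀ u p → act (ε* u) g p ≡ act u g (p + + 1)
  act-ε* u p = trans (ε*-∙ u (window g p)) (cong (u ∙_) (sym (window-suc p)))

  act-+ : ∀ v m p → act v g (p + + m) ≡ act (ε^ m ⊛ v) g p
  act-+ v zero p = trans (cong (act v g) (ℤₚ.+-identityʳ p)) (sym (1ε-⊛ v (window g p)))
  act-+ v (suc m) p = begin
    act v g (p + + suc m)      ≡⟨ cong (act v g) (sym (ℤₚ.+-assoc p (+ 1) (+ m))) ⟩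
    act v g (p + + 1 + + m)    ≡⟨ act-+ v m (p + + 1) ⟩
    act (ε^ m ⊛ v) g (p + + 1) ≡⟨ sym (act-ε* (ε^ m ⊛ v) p) ⟩
    act (ε* (ε^ m ⊛ v)) g p    ≡⟨ sym (ε*-⊛ (ε^ m) v (window g p)) ⟩
    act (ε^ suc m ⊛ v) g p     ∎

  shift : ∀ m p → g (p + + m) ≡ act (ε^ m) g p
  shift m p = begin
    g (p + + m)              ≡⟨ sym (act-1ε (p + + m)) ⟩
    act 1ε g (p + + m)       ≡⟨ act-+ 1ε m p ⟩
    act (ε^ m ⊛ 1ε) g p      ≡⟨ ⊛-1ε (ε^ m) (window g p) ⟩
    act (ε^ m) g p           ∎

  backward : ∀ n → g n ≡ g (n + + 3) - g (n + + 1) - g (n + + 2)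
  backward n = trans (cancel (g n) (g (n + + 1)) (g (n + + 2)))
    (cong (λ x → x - g (n + + 1) - g (n + + 2)) (sym (recurrence n)))
    where
    cancel : ∀ x y z → x ≡ x + y + z - y - z
    cancel = solve-∀

trace-ε^ : ∀ m → trace (ε^ m) ≡ K (+ m)
trace-ε^ m = trans (trace-∙ (ε^ m)) (sym (shift K-isTribonacci m (+ 0)))

+3-from-below : ∀ m → -[1+ suc (suc m) ] + + 3 ≡ - + m
+3-from-below zero = refl
+3-from-below (suc m) = refl

σ₂-ε^ : ∀ m → σ₂ (ε^ m) ≡ K (- + m)
σ₂-ε^ zero = refl
σ₂-ε^ (suc zero) = refl
σ₂-ε^ (suc (suc zero)) = refl
σ₂-ε^ (suc (suc (suc m))) = begin
  σ₂ (ε^ suc (suc (suc m)))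
    ≡⟨ σ₂-ε*³ (ε^ m) ⟩
  σ₂ (ε^ m) - σ₂ (ε^ suc (suc m)) - σ₂ (ε^ suc m)
    ≡⟨ cong₂ _-_ (cong₂ _-_ (σ₂-ε^ m) (σ₂-ε^ (suc (suc m)))) (σ₂-ε^ (suc m)) ⟩
  K (- + m) - K (- + suc (suc m)) - K (- + suc m)
    ≡⟨ cong (λ i → K i - K (- + suc (suc m)) - K (- + suc m)) (sym (+3-from-below m)) ⟩
  K (n + + 3) - K (n + + 1) - K (n + + 2)
    ≡⟨ sym (backward K-isTribonacci n) ⟩
  K (- + suc (suc (suc m))) ∎
  where
  n = -[1+ suc (suc m) ]

-- numer X m a r s is definitionally numerᶻ (λ n → X n r s) m a
numerᶻ : (ℤ → ℤ) → ℤ → ℤ → ℤ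
numerᶻ g m a = (g (a + m) + g (a - m)) + (+ 1 - K m) * g a

module _ {g : ℤ → ℤ} (g-trib : IsTribonacci g) where

  recurrence-stride : ∀ m p →
    g (p + + m + + m + + m) ≡ K (+ m) * g (p + + m + + m) - K (- + m) * g (p + + m) + g p
  recurrence-stride m p = begin
    g (p + + m + + m + + m)
      ≡⟨ at₃ ⟩
    u ^ 3 ∙ window g p
      ≡⟨ cayley-hamilton u (window g p) ⟩
    trace u * act (u ^ 2) g p - σ₂ u * act u g p + norm u * act 1ε g p
      ≡⟨ cong₂ _+_ (cong₂ _-_ (cong₂ _*_ (trace-ε^ m) (sym at₂)) (cong₂ _*_ (σ₂-ε^ m) (sym at₁)))
                   (cong₂ _*_ (norm-ε^ m) (act-1ε g-trib p)) ⟩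
    K (+ m) * g (p + + m + + m) - K (- + m) * g (p + + m) + 1ℤ * g p
      ≡⟨ cong (λ x → K (+ m) * g (p + + m + + m) - K (- + m) * g (p + + m) + x) (ℤₚ.*-identityˡ (g p)) ⟩
    K (+ m) * g (p + + m + + m) - K (- + m) * g (p + + m) + g p ∎
    where
    u = ε^ m
    from-1ε : ∀ q → g q ≡ act 1ε g q
    from-1ε q = sym (act-1ε g-trib q)
    at₁ : g (p + + m) ≡ act u g p
    at₁ = shift g-trib m p
    at₂ : g (p + + m + + m) ≡ act (u ^ 2) g p
    at₂ = trans (from-1ε (p + + m + + m))
      (trans (act-+ g-trib (u ^ 0) m (p + + m)) (act-+ g-trib (u ^ 1) m p))
    at₃ : g (p + + m + + m + + m) ≡ act (u ^ 3) g p
    at₃ = trans (from-1ε (p + + m + + m + + m))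
      (trans (act-+ g-trib (u ^ 0) m (p + + m + + m))
        (trans (act-+ g-trib (u ^ 1) m (p + + m)) (act-+ g-trib (u ^ 2) m p)))

  recurrence-stride-centred : ∀ m a →
    g (a + + m + + m) ≡ K (+ m) * g (a + + m) - K (- + m) * g a + g (a - + m)
  recurrence-stride-centred m a =
    subst (λ b → g (b + + m + + m) ≡ K (+ m) * g (b + + m) - K (- + m) * g b + g (a - + m))
      (cancel a (+ m)) (recurrence-stride m (a - + m))
    where
    cancel : ∀ a m → a - m + m ≡ a
    cancel = solve-∀

  telescope : ∀ m a →
    (K (+ m) - K (- + m)) * g a ≡ numerᶻ g (+ m) (a + + m) - numerᶻ g (+ m) a
  telescope m a = begin
    (k - k′) * g a
      ≡⟨ rearrange k k′ (g (a - + m)) (g a) (g (a + + m)) ⟩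
    (k * g (a + + m) - k′ * g a + g (a - + m) + g a + (+ 1 - k) * g (a + + m))
      - (g (a + + m) + g (a - + m) + (+ 1 - k) * g a)
      ≡⟨ cong₂ (λ x y → (x + g y + (+ 1 - k) * g (a + + m)) - numerᶻ g (+ m) a)
           (sym (recurrence-stride-centred m a)) (sym (cancel a (+ m))) ⟩
    numerᶻ g (+ m) (a + + m) - numerᶻ g (+ m) a ∎
    where
    k = K (+ m)
    k′ = K (- + m)
    rearrange : ∀ k k′ x₀ x₁ x₂ →
      (k - k′) * x₁ ≡ (k * x₂ - k′ * x₁ + x₀ + x₁ + (+ 1 - k) * x₂) - (x₂ + x₀ + (+ 1 - k) * x₁)
    rearrange = solve-∀
    cancel : ∀ a m → a + m - m ≡ a
    cancel = solve-∀

sum-telescopes : ∀ (X : ℤ → Mat) → (∀ r s → IsTribonacci (λ n → X n r s)) → ∀ m j n r s →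
  (K (+ m) - K (- (+ m))) * sumM n (λ i → X (+ m * + i + + j)) r s
    ≡ (numer X (+ m) (+ m * + n + + j) ⊟ numer X (+ m) (+ j)) r s
sum-telescopes X X-trib m j zero r s = begin
  (K (+ m) - K (- + m)) * 0ℤ ≡⟨ ℤₚ.*-zeroʳ (K (+ m) - K (- + m)) ⟩
  0ℤ                         ≡⟨ sym (ℤₚ.+-inverseʳ (N (+ j))) ⟩
  N (+ j) - N (+ j)          ≡⟨ cong (λ i → N (i + + j) - N (+ j)) (sym (ℤₚ.*-zeroʳ (+ m))) ⟩
  N (+ m * + 0 + + j) - N (+ j) ∎
  where
  N = numerᶻ (λ n → X n r s) (+ m)
sum-telescopes X X-trib m j (suc n) r s = begin
  D * (S + g a)             ≡⟨ ℤₚ.*-distribˡ-+ D S (g a) ⟩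
  D * S + D * g a           ≡⟨ cong₂ _+_ (sum-telescopes X X-trib m j n r s) (telescope (X-trib r s) m a) ⟩
  (N a - N (+ j)) + (N (a + + m) - N a) ≡⟨ ℤₚ.+-comm (N a - N (+ j)) _ ⟩
  (N (a + + m) - N a) + (N a - N (+ j)) ≡⟨ ℤₚ.+-minus-telescope (N (a + + m)) (N a) (N (+ j)) ⟩
  N (a + + m) - N (+ j)     ≡⟨ cong (λ i → N i - N (+ j)) (next-term (+ m) (+ n) (+ j)) ⟩
  N (+ m * + suc n + + j) - N (+ j) ∎
  where
  g = λ n → X n r s
  D = K (+ m) - K (- + m)
  S = sumM n (λ i → X (+ m * + i + + j)) r s
  a = + m * + n + + j
  N = numerᶻ g (+ m)
  next-term : ∀ m n j → m * n + j + m ≡ m * (+ 1 + n) + j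
  next-term = solve-∀

mainTheorem3 : (m j n : ℕ) → j < m → 1 ≤ n →
    ((r s : Fin 3) →
      (K (+ m) - K (- (+ m))) * sumM n (λ i → 𝒯 (+ m * + i + + j)) r s
        ≡ (numer 𝒯 (+ m) (+ m * + n + + j) ⊟ numer 𝒯 (+ m) (+ j)) r s)
    × ((r s : Fin 3) →
      (K (+ m) - K (- (+ m))) * sumM n (λ i → 𝒦 (+ m * + i + + j)) r s
        ≡ (numer 𝒦 (+ m) (+ m * + n + + j) ⊟ numer 𝒦 (+ m) (+ j)) r s)
mainTheorem3 m j n _ _ =
  sum-telescopes 𝒯 (entry-isTribonacci _) m j n , sum-telescopes 𝒦 (entry-isTribonacci _) m j n
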